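{- Let $p,q$ be distinct primes, $n,m$ positive integers, and $G=\mathrm{El}(p^n)\times\mathrm{El}(q^m)$. Define $V_1=\{(e,e)\}$, $V_2=\{(a,e): a\in \mathrm{El}(p^n)\setminus\{e\}\}$, $V_3=\{(a,b): a\in\mathrm{El}(p^n)\setminus\{e\},\ b\in\mathrm{El}(q^m)\setminus\{e\}\}$ and $V_4=\{(e,b): b\in\mathrm{El}(q^m)\setminus\{e\}\}$. Then $\{V_1,V_2,V_3,V_4\}$ is an equitable partition of the power graph $\mathcal{P}(G)$.
   Context: $\mathrm{El}(p^n)$ denotes the elementary abelian group of order $p^n$ (every non-identity element has order $p$); $e$ denotes the identity element. For a group $G$, the power graph $\mathcal{P}(G)$ is the simple graph with vertex set $G$ in which distinct $a,b$ are adjacent if and only if $a=b^k$ or $b=a^k$ for some positive integer $k$. A partition $\{V_1,\dots,V_r\}$ of the vertex set of a graph is equitable if for every $i,j$ and all $u,v\in V_i$ one has $|N(u)\cap V_j|=|N(v)\cap V_j|$, where $N(u)$ is the set of neighbours of $u$. -}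

module Defs where

open import Level using (Level; _⊔_)
open import Data.Nat using (ℕ; zero; suc; _+_; NonZero)
open import Data.Nat.DivMod using (_mod_)
open import Data.Nat.Primality using (Prime; prime⇒nonZero)
open import Data.Fin using (Fin; toℕ)
open import Data.Vec using (Vec; zipWith; replicate)
open import Data.Product using (Σ; ∃; _×_; _,_)
open import Data.Sum using (_⊎_)
open import Data.List using (List; length)
open import Data.List.Relation.Unary.Unique.Propositional using (Unique)
open import Data.List.Membership.Propositional using (_∈_)
open import Function.Bundles using (_⇔_)
open import Relation.Nullary using (¬_)
open import Relation.Binary.PropositionalEquality using (_≡_)

HasSize : {A : Set} → (A → Set) → ℕ → Set
HasSize {A} P c =
  Σ (List A) λ xs → length xs ≡ c × Unique xs × (∀ x → P x ⇔ (x ∈ xs))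

IsPartition : {A : Set} {r : ℕ} → (Fin r → A → Set) → Set
IsPartition {A} {r} V =
  (∀ i → ∃ λ x → V i x) ×
  (∀ (x : A) → ∃ λ i → V i x) ×
  (∀ i j (x : A) → V i x → V j x → i ≡ j)

IsEquitablePartition : {A : Set} {r : ℕ} → (A → A → Set) → (Fin r → A → Set) → Set
IsEquitablePartition {A} Adj V =
  IsPartition V ×
  (∀ i j (u v : A) → V i u → V i v →
     ∃ λ c → HasSize (λ w → Adj u w × V j w) c × HasSize (λ w → Adj v w × V j w) c)

-- Elementary abelian group El(p^n), modelled as (ℤ/p)^n = Vec (Fin p) n
-- with componentwise addition mod p.

El : ℕ → ℕ → Set
El p n = Vec (Fin p) n

module _ {p n : ℕ} .{{_ : NonZero p}} where
  elOp : El p n → El p n → El p n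
  elOp = zipWith (λ a b → (toℕ a + toℕ b) mod p)

  elId : El p n
  elId = replicate n (0 mod p)

module ElProd (p q n m : ℕ) (pp : Prime p) (pq : Prime q) where
  private
    instance
      nzp : NonZero p
      nzp = prime⇒nonZero pp
      nzq : NonZero q
      nzq = prime⇒nonZero pq

  G : Set
  G = El p n × El q m

  eP : El p n
  eP = elId

  eQ : El q m
  eQ = elId

  e : G
  e = (eP , eQ)

  _·_ : G → G → G
  (a , b) · (a' , b') = (elOp a a' , elOp b b')

  pow : G → ℕ → G
  pow g zero    = e
  pow g (suc k) = g · pow g k

  PowerAdj : G → G → Set
  PowerAdj x y =
    ¬ (x ≡ y) ×
    ((∃ λ k → x ≡ pow y (suc k)) ⊎ (∃ λ k → y ≡ pow x (suc k)))

  V1 V2 V3 V4 : G → Set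
  V1 (a , b) = a ≡ eP × b ≡ eQ
  V2 (a , b) = ¬ (a ≡ eP) × b ≡ eQ
  V3 (a , b) = ¬ (a ≡ eP) × ¬ (b ≡ eQ)
  V4 (a , b) = a ≡ eP × ¬ (b ≡ eQ)

  blocks : Fin 4 → G → Set
  blocks Fin.zero = V1
  blocks (Fin.suc Fin.zero) = V2
  blocks (Fin.suc (Fin.suc Fin.zero)) = V3
  blocks (Fin.suc (Fin.suc (Fin.suc Fin.zero))) = V4

module Submission where

-- A bijection of G that commutes with every power map x ↦ xᵏ is an automorphism of the
-- power graph. Writing El(pⁿ) additively as (ℤ/p)ⁿ, the k-th power is multiplication by k,
-- so every invertible shear x ↦ x + xᵢ c commutes with powers, and shears move any non-zero
-- vector to the all-ones vector. Products of such maps on the two factors fix each Vⱼ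
-- setwise and act transitively on each of them, so for u, v in a common block some power-graph
-- automorphism carries N(u) ∩ Vⱼ bijectively onto N(v) ∩ Vⱼ. These sets are finite and
-- decidable, hence have a size.

open import Defs
open import Data.Bool using (Bool; true; false)
open import Data.Fin using (Fin; toℕ; fromℕ<)
import Data.Fin as Fin
open import Data.Fin.Patterns using (0F; 1F; 2F; 3F)
open import Data.Fin.Properties using (toℕ-injective; toℕ<n; toℕ-fromℕ<; ¬∀⟶∃¬; any?)
open import Data.List using (List; []; _∷_; length; map; filter; deduplicate; cartesianProductWith; cartesianProduct; allFin)
open import Data.List.Properties using (length-map)
open import Data.List.Membership.Propositional using (_∈_)
open import Data.List.Membership.Propositional.Properties
  using (∈-map⁺; ∈-map⁻; ∈-filter⁺; ∈-filter⁻; ∈-deduplicate⁺; ∈-deduplicate⁻; ∈-cartesianProductWith⁺; ∈-cartesianProduct⁺; ∈-allFin)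
open import Data.List.Relation.Unary.Any using (here)
open import Data.List.Relation.Unary.Unique.Propositional.Properties using (map⁺)
open import Data.List.Relation.Unary.Unique.DecPropositional.Properties using (deduplicate-!)
open import Data.Nat using (ℕ; zero; suc; _+_; _*_; _≤_; _<_; pred; NonZero; >-nonZero; nonTrivial⇒n>1)
import Data.Nat as ℕ
open import Data.Nat.Coprimality using (prime⇒coprime; coprime-Bézout)
open import Data.Nat.Divisibility using (_∣_; m∣m*n; n∣m*n)
open import Data.Nat.DivMod
  using (_%_; _mod_; m%n%n≡m%n; %-distribˡ-+; %-distribˡ-*; m*n%n≡0; m<n⇒m%n≡m; m%n<n; m∣n⇒o%n%m≡o%m)
open import Data.Nat.GCD using (module Bézout)
open import Data.Nat.Primality using (Prime; prime⇒nonTrivial; prime⇒nonZero)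
open import Data.Nat.Properties using (m*n≢0; *-identityˡ; *-comm; +-identityʳ; suc-pred; n≢0⇒n>0)
open import Data.Nat.Tactic.RingSolver using (solve-∀)
open import Data.Product using (Σ; ∃; _×_; _,_; proj₂)
open import Data.Product.Function.NonDependent.Propositional using (_×-↔_; _×-⇔_)
open import Data.Product.Properties using () renaming (≡-dec to ×-≡-dec)
import Data.Sum as Sum
open import Data.Vec using (Vec; []; _∷_; lookup; tabulate)
open import Data.Vec.Properties
  using (≡-dec; tabulate∘lookup; tabulate-cong; lookup∘tabulate; lookup-replicate; lookup-zipWith)
open import Function using (_∘_; const)
open import Function.Bundles using (Inverse; _↔_; mk↔ₛ′; Equivalence; _⇔_; mk⇔)
open import Function.Properties.Inverse using (↔-refl; ↔-sym; ↔-trans)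
open import Function.Related.TypeIsomorphisms using (¬-cong-⇔)
open import Relation.Binary.Bundles using (Setoid)
open import Relation.Binary.Definitions using (DecidableEquality)
open import Relation.Binary.PropositionalEquality as ≡ using (_≡_; refl; cong; cong₂; subst; subst₂)
import Relation.Binary.Reasoning.Setoid as SetoidReasoning
open import Relation.Binary.Structures using (IsEquivalence)
open import Relation.Nullary using (¬_; ¬?; Dec; yes; no; contradiction; _×-dec_; _⊎-dec_)
import Relation.Nullary.Decidable as Dec
open import Relation.Nullary.Decidable using (does; dec-true; dec-false)
open import Relation.Unary using (Decidable)

HasSize-↔ : ∀ {A B : Set} {P : A → Set} {Q : B → Set} {c} (σ : A ↔ B) →
            (∀ x → P x ⇔ Q (Inverse.to σ x)) → HasSize P c → HasSize Q c
HasSize-↔ {Q = Q} σ P⇔Q (xs , |xs|≡c , unique , P⇔∈) =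
  map to xs , ≡.trans (length-map to xs) |xs|≡c , map⁺ to-injective unique , λ y → mk⇔ (Q⇒∈ y) ∈⇒Q
  where
  open Inverse σ
  to-injective : ∀ {x x′} → to x ≡ to x′ → x ≡ x′
  to-injective {x} {x′} e = ≡.trans (≡.sym (strictlyInverseʳ x)) (≡.trans (cong from e) (strictlyInverseʳ x′))
  Q⇒∈ : ∀ y → Q y → y ∈ map to xs
  Q⇒∈ y qy = subst (_∈ map to xs) (strictlyInverseˡ y)
    (∈-map⁺ to (Equivalence.to (P⇔∈ (from y)) (Equivalence.from (P⇔Q (from y))
      (subst Q (≡.sym (strictlyInverseˡ y)) qy))))
  ∈⇒Q : ∀ {y} → y ∈ map to xs → Q y
  ∈⇒Q y∈ with ∈-map⁻ to y∈
  ... | x , x∈xs , refl = Equivalence.to (P⇔Q x) (Equivalence.from (P⇔∈ x) x∈xs)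

HasSize-decidable : ∀ {A : Set} {P : A → Set} → DecidableEquality A →
                    (xs : List A) → (∀ x → x ∈ xs) → Decidable P → ∃ (HasSize P)
HasSize-decidable {A = A} {P = P} _≟_ xs complete P? =
  length ys , ys , refl , deduplicate-! _≟_ _ , λ x → mk⇔ (P⇒∈ x) ∈⇒P
  where
  ys : List A
  ys = deduplicate _≟_ (filter P? xs)
  P⇒∈ : ∀ x → P x → x ∈ ys
  P⇒∈ x px = ∈-deduplicate⁺ _≟_ (∈-filter⁺ P? (complete x) px)
  ∈⇒P : ∀ {x} → x ∈ ys → P x
  ∈⇒P x∈ys = proj₂ (∈-filter⁻ P? {xs = xs} (∈-deduplicate⁻ _≟_ (filter P? xs) x∈ys))

allVecs : ∀ {A : Set} → List A → ∀ r → List (Vec A r)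
allVecs xs zero    = [] ∷ []
allVecs xs (suc r) = cartesianProductWith _∷_ xs (allVecs xs r)

∈-allVecs : ∀ {A : Set} {xs : List A} → (∀ x → x ∈ xs) → ∀ {r} (v : Vec A r) → v ∈ allVecs xs r
∈-allVecs complete []      = here refl
∈-allVecs complete (x ∷ v) = ∈-cartesianProductWith⁺ _∷_ (complete x) (∈-allVecs complete v)

both : ∀ {A B : Set} → A → B → A ⇔ B
both a b = mk⇔ (const b) (const a)

neither : ∀ {A B : Set} → ¬ A → ¬ B → A ⇔ B
neither ¬a ¬b = mk⇔ (λ a → contradiction a ¬a) (λ b → contradiction b ¬b)

prime⇒>1 : ∀ {p} → Prime p → 1 < p
prime⇒>1 {p} pp = nonTrivial⇒n>1 p {{prime⇒nonTrivial pp}}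

module Congruence (p : ℕ) .{{_ : NonZero p}} where

  infix 4 _≈_
  record _≈_ (x y : ℕ) : Set where
    constructor mk≈
    field %-≡ : x % p ≡ y % p

  ≈-isEquivalence : IsEquivalence _≈_
  ≈-isEquivalence = record
    { refl  = mk≈ refl
    ; sym   = λ (mk≈ e) → mk≈ (≡.sym e)
    ; trans = λ (mk≈ e) (mk≈ f) → mk≈ (≡.trans e f)
    }

  ≈-setoid : Setoid _ _
  ≈-setoid = record { isEquivalence = ≈-isEquivalence }

  open IsEquivalence ≈-isEquivalence public
    using () renaming (refl to ≈-refl; sym to ≈-sym; trans to ≈-trans; reflexive to ≡⇒≈)

  %-≈ : ∀ x → x % p ≈ x
  %-≈ x = mk≈ (m%n%n≡m%n x p)

  +-cong : ∀ {x x′ y y′} → x ≈ x′ → y ≈ y′ → x + y ≈ x′ + y′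
  +-cong {x} {x′} {y} {y′} (mk≈ e) (mk≈ f) = mk≈ (begin
    (x + y) % p               ≡⟨ %-distribˡ-+ x y p ⟩
    (x % p + y % p) % p       ≡⟨ cong₂ (λ u v → (u + v) % p) e f ⟩
    (x′ % p + y′ % p) % p     ≡⟨ ≡.sym (%-distribˡ-+ x′ y′ p) ⟩
    (x′ + y′) % p             ∎)
    where open ≡.≡-Reasoning

  *-cong : ∀ {x x′ y y′} → x ≈ x′ → y ≈ y′ → x * y ≈ x′ * y′
  *-cong {x} {x′} {y} {y′} (mk≈ e) (mk≈ f) = mk≈ (begin
    (x * y) % p               ≡⟨ %-distribˡ-* x y p ⟩
    (x % p * (y % p)) % p     ≡⟨ cong₂ (λ u v → (u * v) % p) e f ⟩
    (x′ % p * (y′ % p)) % p   ≡⟨ ≡.sym (%-distribˡ-* x′ y′ p) ⟩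
    (x′ * y′) % p             ∎)
    where open ≡.≡-Reasoning

  +-congˡ : ∀ x {y y′} → y ≈ y′ → x + y ≈ x + y′
  +-congˡ x = +-cong (≈-refl {x})

  *-congˡ : ∀ x {y y′} → y ≈ y′ → x * y ≈ x * y′
  *-congˡ x = *-cong (≈-refl {x})

  *-congʳ : ∀ y {x x′} → x ≈ x′ → x * y ≈ x′ * y
  *-congʳ y x≈x′ = *-cong x≈x′ (≈-refl {y})

  ≈-of-multiple : ∀ {N x y} .{{_ : NonZero N}} → p ∣ N → x % N ≡ y % N → x ≈ y
  ≈-of-multiple {N} {x} {y} p∣N e = mk≈ (begin
    x % p          ≡⟨ ≡.sym (m∣n⇒o%n%m≡o%m p N x p∣N) ⟩
    x % N % p      ≡⟨ cong (_% p) e ⟩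
    y % N % p      ≡⟨ m∣n⇒o%n%m≡o%m p N y p∣N ⟩
    y % p          ∎)
    where open ≡.≡-Reasoning

  x*p≈0 : ∀ x → x * p ≈ 0
  x*p≈0 x = mk≈ (≡.trans (m*n%n≡0 x p) (≡.sym (m*n%n≡0 0 p)))

  1≉0 : 1 < p → ¬ 1 ≈ 0
  1≉0 1<p (mk≈ e) with ≡.trans (≡.sym (m<n⇒m%n≡m 1<p)) (≡.trans e (m*n%n≡0 0 p))
  ... | ()

  -_ : ℕ → ℕ
  - x = pred p * x

  +-inverseʳ : ∀ x → x + - x ≈ 0
  +-inverseʳ x = ≈-trans (≡⇒≈ (begin
    x + pred p * x       ≡⟨⟩
    suc (pred p) * x     ≡⟨ cong (_* x) (suc-pred p) ⟩
    p * x                ≡⟨ *-comm p x ⟩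
    x * p                ∎)) (x*p≈0 x)
    where open ≡.≡-Reasoning

  toℕ-mod : ∀ x → toℕ (x mod p) ≈ x
  toℕ-mod x = ≈-trans (≡⇒≈ (toℕ-fromℕ< (m%n<n x p))) (%-≈ x)

  toℕ-injective-≈ : ∀ {a b : Fin p} → toℕ a ≈ toℕ b → a ≡ b
  toℕ-injective-≈ {a} {b} (mk≈ e) =
    toℕ-injective (≡.trans (≡.sym (m<n⇒m%n≡m (toℕ<n a))) (≡.trans e (m<n⇒m%n≡m (toℕ<n b))))

  invertible : Prime p → ∀ {x} → 0 < x → x < p → ∃ λ y → y * x ≈ 1
  invertible pp {x} x>0 x<p with coprime-Bézout (prime⇒coprime pp {{>-nonZero x>0}} x<p)
  ... | Bézout.+- a b eq = - b , (begin
    pred p * b * x              ≡⟨ ≡.sym (+-identityʳ _) ⟩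
    pred p * b * x + 0          ≈⟨ +-congˡ (pred p * b * x) (≈-sym (≈-trans (≡⇒≈ eq) (x*p≈0 a))) ⟩
    pred p * b * x + (1 + b * x) ≡⟨ rearrange (pred p) b x ⟩
    1 + (b * x + - (b * x))     ≈⟨ +-congˡ 1 (+-inverseʳ (b * x)) ⟩
    1                           ∎)
    where
    open SetoidReasoning ≈-setoid
    rearrange : ∀ m b x → m * b * x + (1 + b * x) ≡ 1 + (b * x + m * (b * x))
    rearrange = solve-∀
  ... | Bézout.-+ a b eq = b , (begin
    b * x       ≡⟨ ≡.sym eq ⟩
    1 + a * p   ≈⟨ +-congˡ 1 (x*p≈0 a) ⟩
    1           ∎)
    where open SetoidReasoning ≈-setoid

record PowerAutomorphism {A : Set} (_^_ : A → ℕ → A) : Set where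
  field
    bijection   : A ↔ A
    homomorphic : ∀ x k → Inverse.to bijection (x ^ k) ≡ Inverse.to bijection x ^ k
  open Inverse bijection public using (to; from; strictlyInverseˡ; strictlyInverseʳ)

  to-injective : ∀ {x y} → to x ≡ to y → x ≡ y
  to-injective {x} {y} e = ≡.trans (≡.sym (strictlyInverseʳ x)) (≡.trans (cong from e) (strictlyInverseʳ y))

SameOrbit : {A : Set} (_^_ : A → ℕ → A) → A → A → Set
SameOrbit _^_ x y = Σ (PowerAutomorphism _^_) λ σ → PowerAutomorphism.to σ x ≡ y

module _ {A : Set} {_^_ : A → ℕ → A} where
  open PowerAutomorphism

  orbit-refl : ∀ {x} → SameOrbit _^_ x x
  orbit-refl = record { bijection = ↔-refl ; homomorphic = λ _ _ → refl } , refl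

  infix 10 _⁻¹
  _⁻¹ : PowerAutomorphism _^_ → PowerAutomorphism _^_
  σ ⁻¹ = record { bijection = ↔-sym (bijection σ) ; homomorphic = from-^ }
    where
    from-^ : ∀ y k → from σ (y ^ k) ≡ from σ y ^ k
    from-^ y k = begin
      from σ (y ^ k)                   ≡⟨ cong (λ z → from σ (z ^ k)) (≡.sym (strictlyInverseˡ σ y)) ⟩
      from σ (to σ (from σ y) ^ k)     ≡⟨ cong (from σ) (≡.sym (homomorphic σ (from σ y) k)) ⟩
      from σ (to σ (from σ y ^ k))     ≡⟨ strictlyInverseʳ σ _ ⟩
      from σ y ^ k                     ∎
      where open ≡.≡-Reasoning

  orbit-sym : ∀ {x y} → SameOrbit _^_ x y → SameOrbit _^_ y x
  orbit-sym {x} (σ , refl) = σ ⁻¹ , strictlyInverseʳ σ x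

  orbit-trans : ∀ {x y z} → SameOrbit _^_ x y → SameOrbit _^_ y z → SameOrbit _^_ x z
  orbit-trans (σ , refl) (τ , refl) =
    record { bijection = ↔-trans (bijection σ) (bijection τ)
           ; homomorphic = λ x k → ≡.trans (cong (to τ) (homomorphic σ x k)) (homomorphic τ (to σ x) k) } ,
    refl

module ElementaryAbelian (p : ℕ) .{{_ : NonZero p}} (n : ℕ) where
  open Congruence p

  infixr 8 _^_
  _^_ : El p n → ℕ → El p n
  a ^ zero  = elId
  a ^ suc k = elOp a (a ^ k)

  coord : El p n → Fin n → ℕ
  coord a j = toℕ (lookup a j)

  coord-injective : ∀ {a b} → (∀ j → coord a j ≈ coord b j) → a ≡ b
  coord-injective {a} {b} h = begin
    a                          ≡⟨ ≡.sym (tabulate∘lookup a) ⟩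
    tabulate (lookup a)        ≡⟨ tabulate-cong (λ j → toℕ-injective-≈ (h j)) ⟩
    tabulate (lookup b)        ≡⟨ tabulate∘lookup b ⟩
    b                          ∎
    where open ≡.≡-Reasoning

  fromCoords : (Fin n → ℕ) → El p n
  fromCoords f = tabulate (λ j → f j mod p)

  coord-fromCoords : ∀ f j → coord (fromCoords f) j ≈ f j
  coord-fromCoords f j = ≈-trans (≡⇒≈ (cong toℕ (lookup∘tabulate _ j))) (toℕ-mod (f j))

  coord-elId : ∀ j → coord elId j ≈ 0
  coord-elId j = ≈-trans (≡⇒≈ (cong toℕ (lookup-replicate j (0 mod p)))) (toℕ-mod 0)

  coord-elOp : ∀ a b j → coord (elOp a b) j ≈ coord a j + coord b j
  coord-elOp a b j = ≈-trans (≡⇒≈ (cong toℕ (lookup-zipWith _ j a b))) (toℕ-mod _)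

  coord-^ : ∀ a k j → coord (a ^ k) j ≈ k * coord a j
  coord-^ a zero    j = coord-elId j
  coord-^ a (suc k) j = ≈-trans (coord-elOp a (a ^ k) j) (+-congˡ (coord a j) (coord-^ a k j))

  ^-cong : ∀ a {k k′} → k ≈ k′ → a ^ k ≡ a ^ k′
  ^-cong a {k} {k′} k≈k′ = coord-injective λ j →
    ≈-trans (coord-^ a k j) (≈-trans (*-congʳ (coord a j) k≈k′) (≈-sym (coord-^ a k′ j)))

  nonidentity-coord : ∀ {a} → ¬ a ≡ elId → ∃ λ i → 0 < coord a i
  nonidentity-coord {a} a≢e with ¬∀⟶∃¬ n (λ i → coord a i ≡ 0) (λ i → coord a i ℕ.≟ 0)
                                  (λ a≡0 → a≢e (coord-injective λ j →
                                     ≈-trans (≡⇒≈ (a≡0 j)) (≈-sym (coord-elId j))))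
  ... | i , aᵢ≢0 = i , n≢0⇒n>0 aᵢ≢0

  shear : Fin n → (Fin n → ℕ) → El p n → El p n
  shear i c x = fromCoords (λ j → coord x j + coord x i * c j)

  shear-^ : ∀ i c x k → shear i c (x ^ k) ≡ shear i c x ^ k
  shear-^ i c x k = coord-injective λ j → begin
    coord (shear i c (x ^ k)) j                   ≈⟨ coord-fromCoords _ j ⟩
    coord (x ^ k) j + coord (x ^ k) i * c j       ≈⟨ +-cong (coord-^ x k j) (*-congʳ (c j) (coord-^ x k i)) ⟩
    k * coord x j + k * coord x i * c j           ≡⟨ distrib k (coord x j) (coord x i) (c j) ⟩
    k * (coord x j + coord x i * c j)             ≈⟨ *-congˡ k (≈-sym (coord-fromCoords _ j)) ⟩
    k * coord (shear i c x) j                     ≈⟨ ≈-sym (coord-^ (shear i c x) k j) ⟩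
    coord (shear i c x ^ k) j                     ∎
    where
    open SetoidReasoning ≈-setoid
    distrib : ∀ k y z w → k * y + k * z * w ≡ k * (y + z * w)
    distrib = solve-∀

  shear-shear : ∀ i c d → (∀ j → c j + (1 + c i) * d j ≈ 0) → ∀ x → shear i d (shear i c x) ≡ x
  shear-shear i c d cancels x = coord-injective coord-cancels
    where
    open SetoidReasoning ≈-setoid
    y : El p n
    y = shear i c x
    xᵢ : ℕ
    xᵢ = coord x i
    regroup : ∀ xⱼ xᵢ cⱼ cᵢ dⱼ → (xⱼ + xᵢ * cⱼ) + (xᵢ + xᵢ * cᵢ) * dⱼ ≡ xⱼ + xᵢ * (cⱼ + (1 + cᵢ) * dⱼ)
    regroup = solve-∀
    annihilate : ∀ xⱼ xᵢ → xⱼ + xᵢ * 0 ≡ xⱼ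
    annihilate = solve-∀
    coord-cancels : ∀ j → coord (shear i d y) j ≈ coord x j
    coord-cancels j = begin
      coord (shear i d y) j                                  ≈⟨ coord-fromCoords _ j ⟩
      coord y j + coord y i * d j                            ≈⟨ +-cong (coord-fromCoords _ j) (*-congʳ (d j) (coord-fromCoords _ i)) ⟩
      (coord x j + xᵢ * c j) + (xᵢ + xᵢ * c i) * d j         ≡⟨ regroup (coord x j) xᵢ (c j) (c i) (d j) ⟩
      coord x j + xᵢ * (c j + (1 + c i) * d j)               ≈⟨ +-congˡ (coord x j) (*-congˡ xᵢ (cancels j)) ⟩
      coord x j + xᵢ * 0                                     ≡⟨ annihilate (coord x j) xᵢ ⟩
      coord x j                                              ∎

  -- The inverse of x ↦ x + xᵢ c is x ↦ x − xᵢ c / (1 + cᵢ).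
  shear-↔ : ∀ i c u → u * (1 + c i) ≈ 1 → El p n ↔ El p n
  shear-↔ i c u u-inverse = mk↔ₛ′ (shear i c) (shear i d) (shear-shear i d c d-cancels) (shear-shear i c d c-cancels)
    where
    open SetoidReasoning ≈-setoid
    d : Fin n → ℕ
    d j = - (u * c j)
    cancel : ∀ t → t + - (u * (1 + c i) * t) ≈ 0
    cancel t = begin
      t + - (u * (1 + c i) * t)   ≈⟨ +-congˡ t (*-congˡ (pred p) (*-congʳ t u-inverse)) ⟩
      t + - (1 * t)               ≡⟨ cong (λ s → t + - s) (*-identityˡ t) ⟩
      t + - t                     ≈⟨ +-inverseʳ t ⟩
      0                           ∎
    c-cancels : ∀ j → c j + (1 + c i) * d j ≈ 0
    c-cancels j = ≈-trans (≡⇒≈ (regroup (pred p) u (c i) (c j))) (cancel (c j))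
      where
      regroup : ∀ m u cᵢ cⱼ → cⱼ + (1 + cᵢ) * (m * (u * cⱼ)) ≡ cⱼ + m * (u * (1 + cᵢ) * cⱼ)
      regroup = solve-∀
    d-cancels : ∀ j → d j + (1 + d i) * c j ≈ 0
    d-cancels j = ≈-trans (≡⇒≈ (regroup (pred p) u (c i) (c j))) (cancel (c j))
      where
      regroup : ∀ m u cᵢ cⱼ → m * (u * cⱼ) + (1 + m * (u * cᵢ)) * cⱼ ≡ cⱼ + m * (u * (1 + cᵢ) * cⱼ)
      regroup = solve-∀

  shear-automorphism : ∀ i c u → u * (1 + c i) ≈ 1 → PowerAutomorphism _^_
  shear-automorphism i c u u-inverse = record
    { bijection = shear-↔ i c u u-inverse ; homomorphic = shear-^ i c }

  identity-invariant : (σ : PowerAutomorphism _^_) → ∀ {a} → a ≡ elId ⇔ PowerAutomorphism.to σ a ≡ elId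
  identity-invariant σ = mk⇔ (λ { refl → fixes-elId }) (λ σa≡e → to-injective (≡.trans σa≡e (≡.sym fixes-elId)))
    where
    open PowerAutomorphism σ
    fixes-elId : to elId ≡ elId
    fixes-elId = homomorphic elId 0

  _≟_ : (a b : El p n) → Dec (a ≡ b)
  _≟_ = ≡-dec Fin._≟_

  ones : El p n
  ones = fromCoords (λ _ → 1)

  module _ (pp : Prime p) where

    ones≢elId : Fin n → ¬ ones ≡ elId
    ones≢elId i ones≡e = 1≉0 (prime⇒>1 pp)
      (≈-trans (≈-sym (coord-fromCoords _ i)) (≈-trans (≡⇒≈ (cong (λ a → coord a i) ones≡e)) (coord-elId i)))

    nonidentity-orbit-ones : ∀ {a} → ¬ a ≡ elId → SameOrbit _^_ a ones
    -- The shear with c = (ones − a) / aᵢ sends a to ones; aᵢ inverts 1 + cᵢ.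
    nonidentity-orbit-ones {a} a≢e with nonidentity-coord a≢e
    ... | i , aᵢ>0 with invertible pp aᵢ>0 (toℕ<n (lookup a i))
    ... | v , v-inverse =
      shear-automorphism i c aᵢ aᵢ-inverse ,
      coord-injective λ j → ≈-trans (coord-fromCoords _ j) (≈-trans (hits-one j) (≈-sym (coord-fromCoords _ j)))
      where
      open SetoidReasoning ≈-setoid
      aᵢ : ℕ
      aᵢ = coord a i
      c : Fin n → ℕ
      c j = v * (1 + - coord a j)
      hits-one : ∀ j → coord a j + aᵢ * c j ≈ 1
      hits-one j = begin
        coord a j + aᵢ * (v * (1 + - coord a j))    ≡⟨ cong (coord a j +_) (*-assoc-comm aᵢ v _) ⟩
        coord a j + v * aᵢ * (1 + - coord a j)      ≈⟨ +-congˡ (coord a j) (*-congʳ _ v-inverse) ⟩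
        coord a j + 1 * (1 + - coord a j)           ≡⟨ regroup (coord a j) (- coord a j) ⟩
        1 + (coord a j + - coord a j)               ≈⟨ +-congˡ 1 (+-inverseʳ (coord a j)) ⟩
        1                                           ∎
        where
        *-assoc-comm : ∀ x y z → x * (y * z) ≡ y * x * z
        *-assoc-comm = solve-∀
        regroup : ∀ x y → x + 1 * (1 + y) ≡ 1 + (x + y)
        regroup = solve-∀
      aᵢ-inverse : aᵢ * (1 + c i) ≈ 1
      aᵢ-inverse = ≈-trans (≡⇒≈ (distrib aᵢ (c i))) (hits-one i)
        where
        distrib : ∀ x y → x * (1 + y) ≡ x + x * y
        distrib = solve-∀

    nonidentity-orbit : ∀ {a b} → ¬ a ≡ elId → ¬ b ≡ elId → SameOrbit _^_ a b
    nonidentity-orbit a≢e b≢e = orbit-trans (nonidentity-orbit-ones a≢e) (orbit-sym (nonidentity-orbit-ones b≢e))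

    identity-status⇒orbit : ∀ {a b} → a ≡ elId ⇔ b ≡ elId → SameOrbit _^_ a b
    identity-status⇒orbit {a} {b} a≡e⇔b≡e with a ≟ elId
    ... | yes refl = subst (SameOrbit _^_ elId) (≡.sym (Equivalence.to a≡e⇔b≡e refl)) orbit-refl
    ... | no a≢e   = nonidentity-orbit a≢e (λ b≡e → a≢e (Equivalence.from a≡e⇔b≡e b≡e))

module PowerGraph (p q n m : ℕ) (pp : Prime p) (pq : Prime q) where
  open ElProd p q n m pp pq
  open PowerAutomorphism

  -- elOp takes its NonZero instance irrelevantly, so these agree with ElProd's private ones.
  private instance
    p≢0 : NonZero p
    p≢0 = prime⇒nonZero pp
    q≢0 : NonZero q
    q≢0 = prime⇒nonZero pq
    pq≢0 : NonZero (p * q)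
    pq≢0 = m*n≢0 p q

  module P = ElementaryAbelian p n
  module Q = ElementaryAbelian q m
  module PQ = Congruence (p * q)

  pow-split : ∀ a b k → pow (a , b) k ≡ (a P.^ k , b Q.^ k)
  pow-split a b zero    = refl
  pow-split a b (suc k) rewrite pow-split a b k = refl

  pow-cong : ∀ x {k k′} → k PQ.≈ k′ → pow x k ≡ pow x k′
  pow-cong (a , b) {k} {k′} (PQ.mk≈ k≡k′) = begin
    pow (a , b) k              ≡⟨ pow-split a b k ⟩
    (a P.^ k , b Q.^ k)        ≡⟨ cong₂ _,_ (P.^-cong a (Congruence.≈-of-multiple p (m∣m*n q) k≡k′))
                                            (Q.^-cong b (Congruence.≈-of-multiple q (n∣m*n p) k≡k′)) ⟩
    (a P.^ k′ , b Q.^ k′)      ≡⟨ ≡.sym (pow-split a b k′) ⟩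
    pow (a , b) k′             ∎
    where open ≡.≡-Reasoning

  _⊗_ : PowerAutomorphism P._^_ → PowerAutomorphism Q._^_ → PowerAutomorphism pow
  f ⊗ g = record { bijection = f×g ; homomorphic = homomorphic-⊗ }
    where
    f×g : G ↔ G
    f×g = bijection f ×-↔ bijection g
    homomorphic-⊗ : ∀ x k → Inverse.to f×g (pow x k) ≡ pow (Inverse.to f×g x) k
    homomorphic-⊗ (a , b) k = begin
      Inverse.to f×g (pow (a , b) k)
        ≡⟨ cong (Inverse.to f×g) (pow-split a b k) ⟩
      (to f (a P.^ k) , to g (b Q.^ k))
        ≡⟨ cong₂ _,_ (homomorphic f a k) (homomorphic g b k) ⟩
      (to f a P.^ k , to g b Q.^ k)
        ≡⟨ ≡.sym (pow-split (to f a) (to g b) k) ⟩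
      pow (to f a , to g b) k
        ∎
      where open ≡.≡-Reasoning

  blocks-cong : ∀ j {a a′ b b′} → a ≡ eP ⇔ a′ ≡ eP → b ≡ eQ ⇔ b′ ≡ eQ → blocks j (a , b) ⇔ blocks j (a′ , b′)
  blocks-cong 0F a⇔a′ b⇔b′ = a⇔a′ ×-⇔ b⇔b′
  blocks-cong 1F a⇔a′ b⇔b′ = ¬-cong-⇔ a⇔a′ ×-⇔ b⇔b′
  blocks-cong 2F a⇔a′ b⇔b′ = ¬-cong-⇔ a⇔a′ ×-⇔ ¬-cong-⇔ b⇔b′
  blocks-cong 3F a⇔a′ b⇔b′ = a⇔a′ ×-⇔ ¬-cong-⇔ b⇔b′

  ⊗-preserves-blocks : ∀ f g j w → blocks j w ⇔ blocks j (to (f ⊗ g) w)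
  ⊗-preserves-blocks f g j (a , b) = blocks-cong j (P.identity-invariant f) (Q.identity-invariant g)

  same-block-identity-status : ∀ i {a b a′ b′} → blocks i (a , b) → blocks i (a′ , b′) →
                               (a ≡ eP ⇔ a′ ≡ eP) × (b ≡ eQ ⇔ b′ ≡ eQ)
  same-block-identity-status 0F (a≡e , b≡e) (a′≡e , b′≡e) = both a≡e a′≡e , both b≡e b′≡e
  same-block-identity-status 1F (a≢e , b≡e) (a′≢e , b′≡e) = neither a≢e a′≢e , both b≡e b′≡e
  same-block-identity-status 2F (a≢e , b≢e) (a′≢e , b′≢e) = neither a≢e a′≢e , neither b≢e b′≢e
  same-block-identity-status 3F (a≡e , b≢e) (a′≡e , b′≢e) = both a≡e a′≡e , neither b≢e b′≢e

  PowerAdj-to : ∀ (σ : PowerAutomorphism pow) {x y} → PowerAdj x y → PowerAdj (to σ x) (to σ y)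
  PowerAdj-to σ (x≢y , power) = x≢y ∘ to-injective σ , Sum.map to-power to-power power
    where
    to-power : ∀ {x y} → ∃ (λ k → x ≡ pow y (suc k)) → ∃ λ k → to σ x ≡ pow (to σ y) (suc k)
    to-power {y = y} (k , refl) = k , homomorphic σ y (suc k)

  PowerAdj-invariant : ∀ (σ : PowerAutomorphism pow) x y → PowerAdj x y ⇔ PowerAdj (to σ x) (to σ y)
  PowerAdj-invariant σ x y = mk⇔ (PowerAdj-to σ)
    (subst₂ PowerAdj (strictlyInverseʳ σ x) (strictlyInverseʳ σ y) ∘ PowerAdj-to (σ ⁻¹))

  Neighbour : Fin 4 → G → G → Set
  Neighbour j u w = PowerAdj u w × blocks j w

  neighbours-transport : ∀ (σ : PowerAutomorphism pow) → (∀ j w → blocks j w ⇔ blocks j (to σ w)) →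
                         ∀ j {u c} → HasSize (Neighbour j u) c → HasSize (Neighbour j (to σ u)) c
  neighbours-transport σ preserves j {u} =
    HasSize-↔ (bijection σ) (λ w → PowerAdj-invariant σ u w ×-⇔ preserves j w)

  _≟G_ : DecidableEquality G
  _≟G_ = ×-≡-dec P._≟_ Q._≟_

  elements : List G
  elements = cartesianProduct (allVecs (allFin p) n) (allVecs (allFin q) m)

  ∈-elements : ∀ x → x ∈ elements
  ∈-elements (a , b) = ∈-cartesianProduct⁺ (∈-allVecs ∈-allFin a) (∈-allVecs ∈-allFin b)

  -- Powers repeat with period p q, so only the exponents below p q need to be tried.
  power? : ∀ x y → Dec (∃ λ k → x ≡ pow y (suc k))
  power? x y = Dec.map′ (λ (i , x≡yⁱ) → toℕ i , x≡yⁱ) reduce (any? λ i → x ≟G pow y (suc (toℕ i)))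
    where
    reduce : ∃ (λ k → x ≡ pow y (suc k)) → ∃ λ (i : Fin (p * q)) → x ≡ pow y (suc (toℕ i))
    reduce (k , x≡yᵏ) = fromℕ< (m%n<n k (p * q)) , ≡.trans x≡yᵏ (pow-cong y (PQ.+-congˡ 1 (PQ.≈-sym
      (PQ.≈-trans (PQ.≡⇒≈ (toℕ-fromℕ< (m%n<n k (p * q)))) (PQ.%-≈ k)))))

  PowerAdj? : ∀ x y → Dec (PowerAdj x y)
  PowerAdj? x y = ¬? (x ≟G y) ×-dec (power? x y ⊎-dec power? y x)

  blocks? : ∀ j x → Dec (blocks j x)
  blocks? 0F (a , b) = a P.≟ eP ×-dec b Q.≟ eQ
  blocks? 1F (a , b) = ¬? (a P.≟ eP) ×-dec b Q.≟ eQ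
  blocks? 2F (a , b) = ¬? (a P.≟ eP) ×-dec ¬? (b Q.≟ eQ)
  blocks? 3F (a , b) = a P.≟ eP ×-dec ¬? (b Q.≟ eQ)

  neighbours-size : ∀ j u → ∃ (HasSize (Neighbour j u))
  neighbours-size j u = HasSize-decidable _≟G_ elements ∈-elements (λ w → PowerAdj? u w ×-dec blocks? j w)

  same-block-neighbours-size : ∀ i j u v → blocks i u → blocks i v →
                               ∃ λ c → HasSize (Neighbour j u) c × HasSize (Neighbour j v) c
  same-block-neighbours-size i j (a , b) (a′ , b′) u∈i v∈i
    with same-block-identity-status i u∈i v∈i
  ... | a⇔a′ , b⇔b′
    with P.identity-status⇒orbit pp a⇔a′ | Q.identity-status⇒orbit pq b⇔b′
  ... | f , refl | g , refl
    with neighbours-size j (a , b)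
  ... | c , size = c , size , neighbours-transport (f ⊗ g) (⊗-preserves-blocks f g) j size

  blocks-nonempty : Fin n → Fin m → ∀ j → ∃ (blocks j)
  blocks-nonempty i i′ 0F = e , refl , refl
  blocks-nonempty i i′ 1F = (P.ones , eQ) , P.ones≢elId pp i , refl
  blocks-nonempty i i′ 2F = (P.ones , Q.ones) , P.ones≢elId pp i , Q.ones≢elId pq i′
  blocks-nonempty i i′ 3F = (eP , Q.ones) , refl , Q.ones≢elId pq i′

  blocks-cover : ∀ x → ∃ λ j → blocks j x
  blocks-cover (a , b) with a P.≟ eP | b Q.≟ eQ
  ... | yes a≡e | yes b≡e = 0F , a≡e , b≡e
  ... | no a≢e  | yes b≡e = 1F , a≢e , b≡e
  ... | no a≢e  | no b≢e  = 2F , a≢e , b≢e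
  ... | yes a≡e | no b≢e  = 3F , a≡e , b≢e

  status-index : Bool → Bool → Fin 4
  status-index true  true  = 0F
  status-index false true  = 1F
  status-index false false = 2F
  status-index true  false = 3F

  block-index : G → Fin 4
  block-index (a , b) = status-index (does (a P.≟ eP)) (does (b Q.≟ eQ))

  blocks⇒block-index : ∀ j x → blocks j x → j ≡ block-index x
  blocks⇒block-index 0F (a , b) (a≡e , b≡e) rewrite dec-true (a P.≟ eP) a≡e  | dec-true (b Q.≟ eQ) b≡e  = refl
  blocks⇒block-index 1F (a , b) (a≢e , b≡e) rewrite dec-false (a P.≟ eP) a≢e | dec-true (b Q.≟ eQ) b≡e  = refl
  blocks⇒block-index 2F (a , b) (a≢e , b≢e) rewrite dec-false (a P.≟ eP) a≢e | dec-false (b Q.≟ eQ) b≢e = refl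
  blocks⇒block-index 3F (a , b) (a≡e , b≢e) rewrite dec-true (a P.≟ eP) a≡e  | dec-false (b Q.≟ eQ) b≢e = refl

  blocks-disjoint : ∀ i j x → blocks i x → blocks j x → i ≡ j
  blocks-disjoint i j x x∈i x∈j = ≡.trans (blocks⇒block-index i x x∈i) (≡.sym (blocks⇒block-index j x x∈j))

lemma4p1 : (p q n m : ℕ) (pp : Prime p) (pq : Prime q) → ¬ (p ≡ q) → 1 ≤ n → 1 ≤ m →
    IsEquitablePartition (ElProd.PowerAdj p q n m pp pq) (ElProd.blocks p q n m pp pq)
lemma4p1 p q n m pp pq _ n≥1 m≥1 =
  (blocks-nonempty (fromℕ< n≥1) (fromℕ< m≥1) , blocks-cover , blocks-disjoint) , same-block-neighbours-size
  where open PowerGraph p q n m pp pq
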